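{- (i) Let $\mathcal{C}_1,\mathcal{C}_2$ be graph properties, both nonempty and both different from $\mathcal{G}$, with $\mathcal{C}_1\neq\mathcal{C}_2$ and $\mathcal{C}_1\neq\overline{\mathcal{C}_2}$. Then $\mathcal{C}_1\not\leq_{d.p.}\mathcal{C}_2$ and $\mathcal{C}_2\not\leq_{d.p.}\mathcal{C}_1$. (ii) Let $\mathcal{C}_1,\mathcal{C}_2$ be graph properties and suppose there is a similarity class $\mathcal{S}$ such that $\mathcal{C}_1\cap\mathcal{S}$ and $\mathcal{C}_2\cap\mathcal{S}$ are both nonempty and both different from $\mathcal{S}$, and $\mathcal{C}_1\cap\mathcal{S}\neq\mathcal{C}_2\cap\mathcal{S}$ and $\mathcal{C}_1\cap\mathcal{S}\neq\overline{\mathcal{C}_2}\cap\mathcal{S}$. Then $\mathcal{C}_1\not\leq_{s.d.p.}\mathcal{C}_2$ and $\mathcal{C}_2\not\leq_{s.d.p.}\mathcal{C}_1$.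
   Context: All graphs are finite without multiple edges; $\mathcal{G}$ is the class of all such graphs. A graph property is a class $\mathcal{C}\subseteq\mathcal{G}$ closed under isomorphism, regarded as the 0/1-valued graph invariant (indicator of membership); $\overline{\mathcal{C}}=\mathcal{G}-\mathcal{C}$. For graph invariants $\mathbf{P},\mathbf{Q}$, $\mathbf{P}\leq_{d.p.}\mathbf{Q}$ means: for all graphs $G_1,G_2$, $\mathbf{Q}(G_1)=\mathbf{Q}(G_2)$ implies $\mathbf{P}(G_1)=\mathbf{P}(G_2)$; $\mathbf{P}\leq_{s.d.p.}\mathbf{Q}$ means the same restricted to similar $G_1,G_2$, where graphs are similar if they have the same numbers of vertices, edges and connected components. A similarity class is the class of all graphs with given such numbers. -}

module Defs where

open import Data.Nat using (ℕ; _≤ᵇ_)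
open import Data.Bool using (Bool; true; false; not; _∧_; if_then_else_)
open import Data.Fin using (Fin; toℕ)
open import Data.List using (List; map; allFin)
open import Data.Nat.ListAction using (sum)
open import Data.Product using (Σ; _×_; _,_; ∃; ∃-syntax)
open import Function.Bundles using (_↔_; _⇔_; Inverse)
open import Function.Definitions using (Surjective)
open import Relation.Binary.PropositionalEquality using (_≡_)
open import Relation.Binary.Construct.Closure.ReflexiveTransitive using (Star)
open import Relation.Nullary using (¬_)

-- A finite graph without multiple edges (loops allowed):
-- vertex set Fin order, symmetric Boolean adjacency.
record Graph : Set where
  field
    order : ℕ
    adj   : Fin order → Fin order → Bool
    sym   : ∀ i j → adj i j ≡ adj j i
open Graph public

_≅_ : Graph → Graph → Set
G ≅ H = Σ (Fin (order G) ↔ Fin (order H)) λ σ →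
          ∀ i j → adj H (Inverse.to σ i) (Inverse.to σ j) ≡ adj G i j

edgeCount : Graph → ℕ
edgeCount G = sum (map (λ i → sum (map (λ j →
    if (toℕ i ≤ᵇ toℕ j) ∧ adj G i j then 1 else 0)
    (allFin (order G)))) (allFin (order G)))

Connected : (G : Graph) → Fin (order G) → Fin (order G) → Set
Connected G = Star (λ a b → adj G a b ≡ true)

HasComponents : Graph → ℕ → Set
HasComponents G k = Σ (Fin (order G) → Fin k) λ c →
  Surjective _≡_ _≡_ c × (∀ i j → (c i ≡ c j) ⇔ Connected G i j)

InSimClass : ℕ → ℕ → ℕ → Graph → Set
InSimClass n m k G = (order G ≡ n) × (edgeCount G ≡ m) × HasComponents G k

Similar : Graph → Graph → Set
Similar G₁ G₂ = (order G₁ ≡ order G₂) × (edgeCount G₁ ≡ edgeCount G₂) ×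
                (∃[ k ] (HasComponents G₁ k × HasComponents G₂ k))

-- a graph property, as its 0/1-valued (Bool) indicator, closed under isomorphism
record GraphProperty : Set where
  field
    mem     : Graph → Bool
    iso-inv : ∀ G H → G ≅ H → mem G ≡ mem H
open GraphProperty public

compl : GraphProperty → GraphProperty
compl C = record { mem = λ G → not (mem C G)
                 ; iso-inv = λ G H e → Relation.Binary.PropositionalEquality.cong not (iso-inv C G H e) }

_≤dp_ : GraphProperty → GraphProperty → Set
P ≤dp Q = ∀ G₁ G₂ → mem Q G₁ ≡ mem Q G₂ → mem P G₁ ≡ mem P G₂

_≤sdp_ : GraphProperty → GraphProperty → Set
P ≤sdp Q = ∀ G₁ G₂ → Similar G₁ G₂ → mem Q G₁ ≡ mem Q G₂ → mem P G₁ ≡ mem P G₂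

Nontrivial : GraphProperty → Set
Nontrivial C = (∃[ G ] mem C G ≡ true) × (∃[ G ] mem C G ≡ false)

SameClass : GraphProperty → GraphProperty → Set
SameClass C D = ∀ G → mem C G ≡ mem D G

NontrivialIn : ℕ → ℕ → ℕ → GraphProperty → Set
NontrivialIn n m k C = (∃[ G ] (InSimClass n m k G × mem C G ≡ true))
                     × (∃[ G ] (InSimClass n m k G × mem C G ≡ false))

SameClassIn : ℕ → ℕ → ℕ → GraphProperty → GraphProperty → Set
SameClassIn n m k C D = ∀ G → InSimClass n m k G → mem C G ≡ mem D G

module Submission where

-- Both parts are instances of one fact about Boolean
-- functions f, g on a domain restricted by a predicate S (all graphs for
-- part (i), one similarity class for part (ii)): if f is determined by g
-- on S and g takes both truth values on S, then f factors on S as h ∘ g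
-- for some h : Bool → Bool.  There are only four such h: the identity,
-- negation and the two constants.  If f also takes both values on S, the
-- constants are excluded, so f agrees with g or with not ∘ g on S.
-- Hence, when f and g are both non-constant on S and f agrees on S with
-- neither g nor not ∘ g, neither function is determined by the other.

open import Defs hiding (sym)
open import Data.Nat using (ℕ)
open import Data.Bool using (Bool; true; false; not; if_then_else_)
open import Data.Bool.Properties using (not-involutive)
open import Data.Unit using (⊤; tt)
open import Data.Product using (Σ; _×_; _,_; ∃-syntax)
open import Data.Sum using (_⊎_; inj₁; inj₂)
open import Relation.Nullary using (¬_)
open import Relation.Binary.PropositionalEquality
  using (_≡_; _≢_; refl; sym; trans; cong)

module _ {X : Set} (S : X → Set) where

  AgreeOn : (X → Bool) → (X → Bool) → Set
  AgreeOn f g = ∀ x → S x → f x ≡ g x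

  TakesBothValues : (X → Bool) → Set
  TakesBothValues f = (∃[ x ] (S x × f x ≡ true)) × (∃[ x ] (S x × f x ≡ false))

  DeterminedBy : (X → Bool) → (X → Bool) → Set
  DeterminedBy f g = ∀ x y → S x → S y → g x ≡ g y → f x ≡ f y

boolEndomap : (h : Bool → Bool) →
  (∀ b → h b ≡ b) ⊎ (∀ b → h b ≡ not b) ⊎ (Σ Bool λ c → ∀ b → h b ≡ c)
boolEndomap h with h true in e₁ | h false in e₂
... | true  | false = inj₁ λ { true → e₁ ; false → e₂ }
... | false | true  = inj₂ (inj₁ λ { true → e₁ ; false → e₂ })
... | true  | true  = inj₂ (inj₂ (true  , λ { true → e₁ ; false → e₂ }))
... | false | false = inj₂ (inj₂ (false , λ { true → e₁ ; false → e₂ }))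

module _ {X : Set} (S : X → Set) (f g : X → Bool) where

  -- If f is determined by g on S and g takes both values there, then
  -- f = h ∘ g on S; h sends g's value at a witness to f's value there.
  factorThrough : DeterminedBy S f g → TakesBothValues S g →
                  Σ (Bool → Bool) λ h → AgreeOn S f (λ x → h (g x))
  factorThrough det ((t , St , gt) , (u , Su , gu)) = h , agree
    where
    h : Bool → Bool
    h b = if b then f t else f u

    agree : AgreeOn S f (λ x → h (g x))
    agree x Sx with g x in gx
    ... | true  = det x t Sx St (trans gx (sym gt))
    ... | false = det x u Sx Su (trans gx (sym gu))

  notDeterminedBy : TakesBothValues S f → TakesBothValues S g →
                    ¬ AgreeOn S f g → ¬ AgreeOn S f (λ x → not (g x)) →
                    ¬ DeterminedBy S f g
  notDeterminedBy ((t , St , ft) , (u , Su , fu)) gBoth f≠g f≠¬g det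
    with factorThrough det gBoth
  ... | h , f≡hg with boolEndomap h
  ... | inj₁ identity =
          f≠g λ x Sx → trans (f≡hg x Sx) (identity (g x))
  ... | inj₂ (inj₁ negation) =
          f≠¬g λ x Sx → trans (f≡hg x Sx) (negation (g x))
  ... | inj₂ (inj₂ (c , constant)) = true≢false
          (trans (sym ft) (trans (constant-f t St) (sym (constant-f u Su))))
          fu
    where
    constant-f : ∀ x → S x → f x ≡ c
    constant-f x Sx = trans (f≡hg x Sx) (constant (g x))

    true≢false : ∀ {b} → true ≡ b → b ≢ false
    true≢false refl ()

-- The hypotheses of notDeterminedBy are symmetric in f and g, so mutual
-- incomparability follows; the negation case uses a ≡ not b ⇒ b ≡ not a.
incomparable : {X : Set} (S : X → Set) (f g : X → Bool) →
  TakesBothValues S f → TakesBothValues S g →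
  ¬ AgreeOn S f g → ¬ AgreeOn S f (λ x → not (g x)) →
  ¬ DeterminedBy S f g × ¬ DeterminedBy S g f
incomparable S f g fBoth gBoth f≠g f≠¬g =
    notDeterminedBy S f g fBoth gBoth f≠g f≠¬g
  , notDeterminedBy S g f gBoth fBoth
      (λ g≡f → f≠g λ x Sx → sym (g≡f x Sx))
      (λ g≡¬f → f≠¬g λ x Sx → swapNot (g≡¬f x Sx))
  where
  swapNot : ∀ {a b} → a ≡ not b → b ≡ not a
  swapNot {b = b} a≡¬b = sym (trans (cong not a≡¬b) (not-involutive b))

sameClassSimilar : ∀ n m k (G₁ G₂ : Graph) →
  InSimClass n m k G₁ → InSimClass n m k G₂ → Similar G₁ G₂
sameClassSimilar _ _ _ _ _ (o₁ , e₁ , c₁) (o₂ , e₂ , c₂) =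
  trans o₁ (sym o₂) , trans e₁ (sym e₂) , _ , c₁ , c₂

everywhere : Graph → Set
everywhere _ = ⊤

nontrivialEverywhere : ∀ C → Nontrivial C → TakesBothValues everywhere (mem C)
nontrivialEverywhere C ((a , a∈C) , (b , b∉C)) = (a , tt , a∈C) , (b , tt , b∉C)

-- Part (i): ≤dp is determination on the class of all graphs.
notDpComparable : ∀ (C₁ C₂ : GraphProperty) → Nontrivial C₁ → Nontrivial C₂ →
  ¬ SameClass C₁ C₂ → ¬ SameClass C₁ (compl C₂) →
  ¬ (C₁ ≤dp C₂) × ¬ (C₂ ≤dp C₁)
notDpComparable C₁ C₂ nt₁ nt₂ C₁≠C₂ C₁≠¬C₂
  with incomparable everywhere (mem C₁) (mem C₂)
         (nontrivialEverywhere C₁ nt₁) (nontrivialEverywhere C₂ nt₂)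
         (λ agree → C₁≠C₂ λ G → agree G tt)
         (λ agree → C₁≠¬C₂ λ G → agree G tt)
... | ¬det₁₂ , ¬det₂₁ =
        (λ dp → ¬det₁₂ λ G₁ G₂ _ _ → dp G₁ G₂)
      , (λ dp → ¬det₂₁ λ G₁ G₂ _ _ → dp G₁ G₂)

-- Part (ii): ≤sdp gives determination on the similarity class (n, m, k).
-- NontrivialIn and SameClassIn are TakesBothValues and AgreeOn for this
-- class, so the hypotheses pass to incomparable unchanged.
notSdpComparable : ∀ (C₁ C₂ : GraphProperty) (n m k : ℕ) →
  NontrivialIn n m k C₁ → NontrivialIn n m k C₂ →
  ¬ SameClassIn n m k C₁ C₂ → ¬ SameClassIn n m k C₁ (compl C₂) →
  ¬ (C₁ ≤sdp C₂) × ¬ (C₂ ≤sdp C₁)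
notSdpComparable C₁ C₂ n m k nt₁ nt₂ C₁≠C₂ C₁≠¬C₂
  with incomparable (InSimClass n m k) (mem C₁) (mem C₂) nt₁ nt₂ C₁≠C₂ C₁≠¬C₂
... | ¬det₁₂ , ¬det₂₁ = (λ sdp → ¬det₁₂ (determined C₁ C₂ sdp))
                      , (λ sdp → ¬det₂₁ (determined C₂ C₁ sdp))
  where
  determined : ∀ P Q → P ≤sdp Q → DeterminedBy (InSimClass n m k) (mem P) (mem Q)
  determined P Q sdp G₁ G₂ s₁ s₂ = sdp G₁ G₂ (sameClassSimilar n m k G₁ G₂ s₁ s₂)

proposition6 :
    (∀ (C₁ C₂ : GraphProperty) → Nontrivial C₁ → Nontrivial C₂ →
       ¬ SameClass C₁ C₂ → ¬ SameClass C₁ (compl C₂) →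
       ¬ (C₁ ≤dp C₂) × ¬ (C₂ ≤dp C₁))
    ×
    (∀ (C₁ C₂ : GraphProperty) →
       (∃[ n ] ∃[ m ] ∃[ k ] (NontrivialIn n m k C₁ × NontrivialIn n m k C₂ ×
          ¬ SameClassIn n m k C₁ C₂ × ¬ SameClassIn n m k C₁ (compl C₂))) →
       ¬ (C₁ ≤sdp C₂) × ¬ (C₂ ≤sdp C₁))
proposition6 =
    notDpComparable
  , λ { C₁ C₂ (n , m , k , nt₁ , nt₂ , C₁≠C₂ , C₁≠¬C₂) →
          notSdpComparable C₁ C₂ n m k nt₁ nt₂ C₁≠C₂ C₁≠¬C₂ }
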